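{- Let $k\geq 3$, $1<t<k$, and $1\le d<t$ with $d+t\le k$, and suppose $t\equiv k\pmod 2$ or $d\not\equiv t\pmod 2$. Let $x\in\{0,1\}^k$ have weight $d$. Then $\mathrm{Pol}(\mathbf{I}_{t,k}\cup\{x\},\mathbf{NAE}_k)$ contains no 2-block-symmetric function of arity $2k+1$.
   Context: Weight of a Boolean tuple = number of 1's. $\mathbf{I}_{t,k}\cup\{x\}$: Boolean structure whose single $k$-ary relation is the set of all tuples of weight $t$ together with $x$. $\mathbf{NAE}_k$: Boolean structure with relation $\{0,1\}^k\setminus\{0^k,1^k\}$. A polymorphism of arity $m$ of $(\mathbf{A},\mathbf{B})$ (single $k$-ary relations $R,S$) is $f:\{0,1\}^m\to\{0,1\}$ such that for every $k\times m$ matrix with columns in $R$, applying $f$ row-wise gives a tuple in $S$. A function of arity $2n+1$ is 2-block-symmetric if it is invariant under every permutation of its coordinates that preserves parity of positions. -}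

module Defs where

open import Data.Nat using (ℕ; zero; suc; _+_; _%_)
open import Data.Bool using (Bool; true; false)
open import Data.Fin using (Fin; toℕ)
open import Data.Fin.Permutation using (Permutation′; _⟨$⟩ʳ_)
open import Data.Product using (_×_)
open import Data.Sum using (_⊎_)
open import Relation.Nullary using (¬_)
open import Relation.Binary.PropositionalEquality using (_≡_)

Tuple : ℕ → Set
Tuple k = Fin k → Bool

Rel : ℕ → Set₁
Rel k = Tuple k → Set

bit : Bool → ℕ
bit true  = 1
bit false = 0

weight : ∀ {k} → Tuple k → ℕ
weight {zero}  y = 0
weight {suc k} y = bit (y Fin.zero) + weight (λ i → y (Fin.suc i))

ItkPlus : (k t : ℕ) → Tuple k → Rel k
ItkPlus k t x y = (weight y ≡ t) ⊎ (∀ i → y i ≡ x i)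

NAE : (k : ℕ) → Rel k
NAE k y = ¬ (∀ i → y i ≡ false) × ¬ (∀ i → y i ≡ true)

IsPolymorphism : ∀ {k} (m : ℕ) → Rel k → Rel k → ((Fin m → Bool) → Bool) → Set
IsPolymorphism {k} m R S f =
  (M : Fin k → Fin m → Bool) →
  (∀ j → R (λ i → M i j)) →
  S (λ i → f (M i))

TwoBlockSymmetric : (n : ℕ) → ((Fin (suc (n + n)) → Bool) → Bool) → Set
TwoBlockSymmetric n f =
  (π : Permutation′ (suc (n + n))) →
  (∀ i → toℕ (π ⟨$⟩ʳ i) % 2 ≡ toℕ i % 2) →
  ∀ (v : Fin (suc (n + n)) → Bool) → f (λ i → v (π ⟨$⟩ʳ i)) ≡ f v

module Submission where

-- If f is 2-block-symmetric, f v depends only on the numbers of ones of v in the even and in the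
-- odd positions; let H a be its value with a ones in the even and t ones in the odd positions.
-- Stack k rows of length 2k + 1 so that every column is x or has weight t, i.e. lies in
-- I_{t,k} ∪ {x}. A greedy, Gale–Ryser type construction realises any row sums compatible with
-- these column sums, so we can make all rows carry t ones in odd positions and prescribed numbers
-- of ones in even positions; as f is a polymorphism into NAE_k, the values H on the rows cannot
-- all agree. Suitable row sums give H (t + 1) ≠ H t, then H t ≠ H (t − 1) (with about t / (t − d)
-- copies of x, which needs d + t ≤ k) and H (t + 1) ≠ H (t − 1) (using that k + t or k + d is
-- even). But three Boolean values cannot be pairwise distinct.

open import Defs
open import Data.Nat using (ℕ; zero; suc; _+_; _*_; _∸_; _%_; _≤_; _<_; _<ᵇ_; _≤?_; z≤n; s≤s; s≤s⁻¹; ⌊_/2⌋; ⌈_/2⌉)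
open import Data.Nat.Properties
open import Data.Nat.Tactic.RingSolver using (solve-∀)
open import Algebra.Properties.Semiring.Sum +-*-semiring using (sum; sum-cong-≗; ∑-distrib-+; *-distribʳ-sum)
open import Data.Bool using (Bool; true; false; f≤t; b≤b)
import Data.Bool as Bool
open import Data.Bool.Properties using (≤-maximum)
open import Data.Empty using (⊥; ⊥-elim)
open import Data.Fin using (Fin; zero; suc; toℕ)
open import Data.Fin.Permutation using (Permutation′; _⟨$⟩ʳ_; _∘ₚ_; lift₀; transpose)
import Data.Fin.Permutation as Perm
open import Data.Fin.Patterns using (0F; 1F)
open import Data.Product using (Σ; ∃; ∃₂; _×_; _,_; proj₁; proj₂)
open import Data.Sum using (_⊎_; inj₁; inj₂; [_,_]′)
import Data.Sum as Sum
open import Data.Sum.Properties using ([,]-map; [,]-cong)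
open import Data.Sum.Function.Propositional using (_⊎-↔_)
open import Data.Vec.Functional using (_∷_; []; tail; replicate)
open import Function using (_∘_; _↔_; mk↔ₛ′)
open import Function.Properties.Inverse using (↔-trans; ↔-sym)
open import Relation.Nullary using (¬_; yes; no)
open import Relation.Nullary.Reflects using (ofʸ; ofⁿ)
open import Relation.Binary.PropositionalEquality

weight≡sum : ∀ {n} (u : Tuple n) → weight u ≡ sum (bit ∘ u)
weight≡sum {zero}  u = refl
weight≡sum {suc n} u = cong (bit (u zero) +_) (weight≡sum (tail u))

weight-cong : ∀ {n} {u v : Tuple n} → (∀ i → u i ≡ v i) → weight u ≡ weight v
weight-cong {u = u} {v} u≗v = trans (weight≡sum u) (trans (sum-cong-≗ (cong bit ∘ u≗v)) (sym (weight≡sum v)))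

weight-all-true : ∀ n → weight {n} (λ _ → true) ≡ n
weight-all-true zero    = refl
weight-all-true (suc n) = cong suc (weight-all-true n)

sum-mono-≤ : ∀ {n} {r r′ : Fin n → ℕ} → (∀ i → r i ≤ r′ i) → sum r ≤ sum r′
sum-mono-≤ {zero}  _    = z≤n
sum-mono-≤ {suc n} r≤r′ = +-mono-≤ (r≤r′ zero) (sum-mono-≤ (r≤r′ ∘ suc))

sum-const : ∀ n c → sum {n} (λ _ → c) ≡ n * c
sum-const zero    c = refl
sum-const (suc n) c = cong (c +_) (sum-const n c)

weight*≡sum : ∀ {n} (A : Tuple n) c → weight A * c ≡ sum (λ i → bit (A i) * c)
weight*≡sum A c = trans (cong (_* c) (weight≡sum A)) (*-distribʳ-sum c (bit ∘ A))

infix 4 _⊆_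
_⊆_ : ∀ {n} → Tuple n → Tuple n → Set
A ⊆ B = ∀ i → A i Bool.≤ B i

weight-mono : ∀ {n} {A B : Tuple n} → A ⊆ B → weight A ≤ weight B
weight-mono {zero}          _   = z≤n
weight-mono {suc n} {A} {B} A⊆B with A zero | B zero | A⊆B zero
... | _     | _ | f≤t = m≤n⇒m≤1+n (weight-mono (A⊆B ∘ suc))
... | true  | _ | b≤b = s≤s (weight-mono (A⊆B ∘ suc))
... | false | _ | b≤b = weight-mono (A⊆B ∘ suc)

weight≤length : ∀ {n} (u : Tuple n) → weight u ≤ n
weight≤length {n} u = ≤-trans (weight-mono (≤-maximum ∘ u)) (≤-reflexive (weight-all-true n))

∷-mono-⊆ : ∀ {n} {a b} {A B : Tuple n} → a Bool.≤ b → A ⊆ B → a ∷ A ⊆ b ∷ B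
∷-mono-⊆ a≤b A⊆B zero    = a≤b
∷-mono-⊆ a≤b A⊆B (suc i) = A⊆B i

subset-of-weight : ∀ {n} {A B : Tuple n} → A ⊆ B → ∀ s → weight A ≤ s → s ≤ weight B →
  Σ (Tuple n) λ S → A ⊆ S × S ⊆ B × weight S ≡ s

∷-subset-of-weight : ∀ {n} {a b} {A B : Tuple n} → a Bool.≤ b → A ⊆ B →
  ∀ s → bit a + weight A ≤ s → s ≤ bit b + weight B →
  Σ (Tuple (suc n)) λ S → a ∷ A ⊆ S × S ⊆ b ∷ B × weight S ≡ s

subset-of-weight {zero} _ s _ s≤0 = [] , (λ ()) , (λ ()) , sym (n≤0⇒n≡0 s≤0)
subset-of-weight {suc n} A⊆B s wA≤s s≤wB
  with S , A⊆S , S⊆B , wS ← ∷-subset-of-weight (A⊆B zero) (A⊆B ∘ suc) s wA≤s s≤wB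
  = S , (λ { zero → A⊆S zero ; (suc i) → A⊆S (suc i) })
      , (λ { zero → S⊆B zero ; (suc i) → S⊆B (suc i) }) , wS

∷-subset-of-weight {a = true} b≤b A⊆B (suc s) (s≤s wA≤s) (s≤s s≤wB)
  with S , A⊆S , S⊆B , wS ← subset-of-weight A⊆B s wA≤s s≤wB
  = true ∷ S , ∷-mono-⊆ b≤b A⊆S , ∷-mono-⊆ b≤b S⊆B , cong suc wS
∷-subset-of-weight {a = false} b≤b A⊆B s wA≤s s≤wB
  with S , A⊆S , S⊆B , wS ← subset-of-weight A⊆B s wA≤s s≤wB
  = false ∷ S , ∷-mono-⊆ b≤b A⊆S , ∷-mono-⊆ b≤b S⊆B , wS
∷-subset-of-weight {B = B} f≤t A⊆B s wA≤s s≤1+wB with s ≤? weight B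
... | yes s≤wB with S , A⊆S , S⊆B , wS ← subset-of-weight A⊆B s wA≤s s≤wB
  = false ∷ S , ∷-mono-⊆ b≤b A⊆S , ∷-mono-⊆ f≤t S⊆B , wS
∷-subset-of-weight f≤t A⊆B (suc s) wA≤s (s≤s s≤wB) | no s≰wB
  with S , A⊆S , S⊆B , wS ← subset-of-weight A⊆B s (≤-trans (weight-mono A⊆B) (s≤s⁻¹ (≰⇒> s≰wB))) s≤wB
  = true ∷ S , ∷-mono-⊆ f≤t A⊆S , ∷-mono-⊆ b≤b S⊆B , cong suc wS
∷-subset-of-weight f≤t A⊆B zero _ _ | no 0≰wB = ⊥-elim (0≰wB z≤n)

-- 0/1 matrices with prescribed row and column sums

module _ (N : ℕ) where
  private
    full nonzero : ℕ → Bool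
    full n    = N <ᵇ n
    nonzero n = 0 <ᵇ n

    full≤nonzero : ∀ n → full n Bool.≤ nonzero n
    full≤nonzero zero    = b≤b
    full≤nonzero (suc n) with N <ᵇ suc n
    ... | true  = b≤b
    ... | false = f≤t

    full*≤ : ∀ n → bit (full n) * suc N ≤ n
    full*≤ n with N <ᵇ n | <ᵇ-reflects-< N n
    ... | true  | ofʸ N<n = ≤-trans (≤-reflexive (+-identityʳ (suc N))) N<n
    ... | false | _       = z≤n

    ≤nonzero* : ∀ n → n ≤ suc N → n ≤ bit (nonzero n) * suc N
    ≤nonzero* zero    _   = z≤n
    ≤nonzero* (suc n) n≤N = ≤-trans n≤N (≤-reflexive (sym (+-identityʳ (suc N))))

    bit≤ : ∀ {b} n → b Bool.≤ nonzero n → bit b ≤ n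
    bit≤ {false} n       _ = z≤n
    bit≤ {true}  (suc n) _ = s≤s z≤n

    ∸bit≤ : ∀ {b} n → n ≤ suc N → full n Bool.≤ b → n ∸ bit b ≤ N
    ∸bit≤ {true}  n n≤1+N _ = ∸-monoˡ-≤ 1 n≤1+N
    ∸bit≤ {false} n _ full≤false with N <ᵇ n | <ᵇ-reflects-< N n | full≤false
    ... | false | ofⁿ N≮n | b≤b = ≮⇒≥ N≮n

    weight-full≤ : ∀ {k} t (r : Fin k → ℕ) → sum r ≡ t * suc N → weight (full ∘ r) ≤ t
    weight-full≤ t r Σr = *-cancelʳ-≤ _ _ (suc N) (begin
      weight (full ∘ r) * suc N ≡⟨ weight*≡sum (full ∘ r) (suc N) ⟩
      sum (λ i → bit (full (r i)) * suc N) ≤⟨ sum-mono-≤ (full*≤ ∘ r) ⟩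
      sum r                     ≡⟨ Σr ⟩
      t * suc N                 ∎)
      where open ≤-Reasoning

    weight-nonzero≥ : ∀ {k} t (r : Fin k → ℕ) → (∀ i → r i ≤ suc N) → sum r ≡ t * suc N →
      t ≤ weight (nonzero ∘ r)
    weight-nonzero≥ t r r≤ Σr = *-cancelʳ-≤ _ _ (suc N) (begin
      t * suc N                    ≡⟨ Σr ⟨
      sum r                        ≤⟨ sum-mono-≤ (λ i → ≤nonzero* (r i) (r≤ i)) ⟩
      sum (λ i → bit (nonzero (r i)) * suc N) ≡⟨ weight*≡sum (nonzero ∘ r) (suc N) ⟨
      weight (nonzero ∘ r) * suc N ∎)
      where open ≤-Reasoning

  -- Full rows must meet the peeled column and nonzero rows may; counting shows that t lies
  -- between their numbers.
  peel-column : ∀ {k} t (r : Fin k → ℕ) → (∀ i → r i ≤ suc N) → sum r ≡ t * suc N →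
    Σ (Tuple k) λ S → weight S ≡ t × (∀ i → bit (S i) ≤ r i) ×
      (∀ i → r i ∸ bit (S i) ≤ N) × sum (λ i → r i ∸ bit (S i)) ≡ t * N
  peel-column t r r≤ Σr
    with S , full⊆S , S⊆nonzero , wS ←
      subset-of-weight (full≤nonzero ∘ r) t (weight-full≤ t r Σr) (weight-nonzero≥ t r r≤ Σr)
    = S , wS , S≤r , (λ i → ∸bit≤ (r i) (r≤ i) (full⊆S i)) , +-cancelʳ-≡ t _ _ (begin
      sum (λ i → r i ∸ bit (S i)) + t      ≡⟨ cong (_ +_) (trans (sym wS) (weight≡sum S)) ⟩
      sum (λ i → r i ∸ bit (S i)) + sum (bit ∘ S) ≡⟨ ∑-distrib-+ (λ i → r i ∸ bit (S i)) (bit ∘ S) ⟨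
      sum (λ i → r i ∸ bit (S i) + bit (S i)) ≡⟨ sum-cong-≗ (λ i → m∸n+n≡m (S≤r i)) ⟩
      sum r                                ≡⟨ Σr ⟩
      t * suc N                            ≡⟨ *-suc t N ⟩
      t + t * N                            ≡⟨ +-comm t (t * N) ⟩
      t * N + t                            ∎)
    where
    open ≡-Reasoning
    S≤r : ∀ i → bit (S i) ≤ r i
    S≤r i = bit≤ (r i) (S⊆nonzero i)

matrix-with-margins : ∀ {k} t N (r : Fin k → ℕ) → (∀ i → r i ≤ N) → sum r ≡ t * N →
  Σ (Fin k → Fin N → Bool) λ M → (∀ j → weight (λ i → M i j) ≡ t) × (∀ i → weight (M i) ≡ r i)
matrix-with-margins t zero r r≤0 _ = (λ _ ()) , (λ ()) , λ i → sym (n≤0⇒n≡0 (r≤0 i))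
matrix-with-margins t (suc N) r r≤ Σr
  with S , wS , S≤r , r′≤N , Σr′ ← peel-column N t r r≤ Σr
  with M , columns , rows ← matrix-with-margins t N _ r′≤N Σr′
  = (λ i → S i ∷ M i) , (λ { zero → wS ; (suc j) → columns j })
  , λ i → trans (cong (bit (S i) +_) (rows i)) (m+[n∸m]≡n (S≤r i))

ItkPlus-resp : ∀ {k t} {x u v : Tuple k} → (∀ i → u i ≡ v i) → ItkPlus k t x u → ItkPlus k t x v
ItkPlus-resp u≗v (inj₁ wu≡t)  = inj₁ (trans (sym (weight-cong u≗v)) wu≡t)
ItkPlus-resp u≗v (inj₂ u≗x)   = inj₂ (λ i → trans (sym (u≗v i)) (u≗x i))

matrix-with-x-columns : ∀ {k} t (x : Tuple k) e N {W} → e + N ≡ W →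
  (r : Fin k → ℕ) → (∀ i → r i ≤ N) → sum r ≡ t * N →
  Σ (Fin k → Fin W → Bool) λ M → (∀ j → ItkPlus k t x (λ i → M i j)) × (∀ i → weight (M i) ≡ e * bit (x i) + r i)
matrix-with-x-columns t x zero N refl r r≤N Σr with M , columns , rows ← matrix-with-margins t N r r≤N Σr
  = M , inj₁ ∘ columns , rows
matrix-with-x-columns t x (suc e) N refl r r≤N Σr with M , columns , rows ← matrix-with-x-columns t x e N refl r r≤N Σr
  = (λ i → x i ∷ M i) , (λ { zero → inj₂ (λ _ → refl) ; (suc j) → columns j })
  , λ i → trans (cong (bit (x i) +_) (rows i)) (sym (+-assoc (bit (x i)) _ _))

-- Rearrangements and the blocks of even and odd positions

first : ∀ {n} → ℕ → Fin n → Bool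
first {zero}  _       = []
first {suc n} zero    = replicate (suc n) false
first {suc n} (suc a) = true ∷ first a

infix 4 _≈ₚ_
record _≈ₚ_ {n} (u v : Fin n → Bool) : Set where
  constructor _,_
  field
    perm    : Permutation′ n
    permute : ∀ j → u (perm ⟨$⟩ʳ j) ≡ v j

≈ₚ-reflexive : ∀ {n} {u v : Fin n → Bool} → (∀ j → u j ≡ v j) → u ≈ₚ v
≈ₚ-reflexive u≗v = Perm.id , u≗v

≈ₚ-trans : ∀ {n} {u v w : Fin n → Bool} → u ≈ₚ v → v ≈ₚ w → u ≈ₚ w
≈ₚ-trans (σ , uσ≗v) (τ , vτ≗w) = τ ∘ₚ σ , λ j → trans (uσ≗v (τ ⟨$⟩ʳ j)) (vτ≗w j)

≈ₚ-cons : ∀ {n} b {u v : Fin n → Bool} → u ≈ₚ v → b ∷ u ≈ₚ b ∷ v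
≈ₚ-cons b (σ , uσ≗v) = lift₀ σ , λ { zero → refl ; (suc j) → uσ≗v j }

≈ₚ-swap : ∀ {n} a b (u : Fin n → Bool) → a ∷ b ∷ u ≈ₚ b ∷ a ∷ u
≈ₚ-swap a b u = transpose 0F 1F , λ { zero → refl ; (suc zero) → refl ; (suc (suc j)) → refl }

first≈ₚfalse∷first : ∀ {n} a → a ≤ n → first {suc n} a ≈ₚ false ∷ first a
first≈ₚfalse∷first {zero}  zero    _         = ≈ₚ-reflexive λ { zero → refl }
first≈ₚfalse∷first {suc n} zero    _         = ≈ₚ-reflexive λ { zero → refl ; (suc j) → refl }
first≈ₚfalse∷first {suc n} (suc a) (s≤s a≤n) =
  ≈ₚ-trans (≈ₚ-cons true (first≈ₚfalse∷first a a≤n)) (≈ₚ-swap true false (first a))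

first-weight≈ₚ : ∀ {n} (u : Fin n → Bool) → first (weight u) ≈ₚ u
first-weight≈ₚ {zero}  u = ≈ₚ-reflexive λ ()
first-weight≈ₚ {suc n} u =
  ≈ₚ-trans (≈ₚ-trans (first-∷ (u zero)) (≈ₚ-cons (u zero) (first-weight≈ₚ (tail u))))
           (≈ₚ-reflexive λ { zero → refl ; (suc j) → refl })
  where
  first-∷ : ∀ b → first (bit b + weight (tail u)) ≈ₚ b ∷ first (weight (tail u))
  first-∷ true  = ≈ₚ-reflexive λ _ → refl
  first-∷ false = first≈ₚfalse∷first _ (weight≤length (tail u))

split : ∀ {N} → Fin N → Fin ⌈ N /2⌉ ⊎ Fin ⌊ N /2⌋
split {suc zero}    zero          = inj₁ zero
split {suc (suc N)} zero          = inj₁ zero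
split {suc (suc N)} (suc zero)    = inj₂ zero
split {suc (suc N)} (suc (suc j)) = Sum.map suc suc (split j)

join : ∀ {N} → Fin ⌈ N /2⌉ ⊎ Fin ⌊ N /2⌋ → Fin N
join {suc zero}    (inj₁ zero)    = zero
join {suc (suc N)} (inj₁ zero)    = zero
join {suc (suc N)} (inj₁ (suc m)) = suc (suc (join (inj₁ m)))
join {suc (suc N)} (inj₂ zero)    = suc zero
join {suc (suc N)} (inj₂ (suc m)) = suc (suc (join (inj₂ m)))

split-join : ∀ {N} (p : Fin ⌈ N /2⌉ ⊎ Fin ⌊ N /2⌋) → split (join p) ≡ p
split-join {suc zero}    (inj₁ zero)    = refl
split-join {suc (suc N)} (inj₁ zero)    = refl
split-join {suc (suc N)} (inj₁ (suc m)) = cong (Sum.map suc suc) (split-join (inj₁ m))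
split-join {suc (suc N)} (inj₂ zero)    = refl
split-join {suc (suc N)} (inj₂ (suc m)) = cong (Sum.map suc suc) (split-join (inj₂ m))

join-split : ∀ {N} (j : Fin N) → join (split j) ≡ j
join-split {suc zero}    zero          = refl
join-split {suc (suc N)} zero          = refl
join-split {suc (suc N)} (suc zero)    = refl
join-split {suc (suc N)} (suc (suc j)) with split j | join-split j
... | inj₁ m | eq = cong (λ i → suc (suc i)) eq
... | inj₂ m | eq = cong (λ i → suc (suc i)) eq

blocks : ∀ {N} → Fin N ↔ (Fin ⌈ N /2⌉ ⊎ Fin ⌊ N /2⌋)
blocks = mk↔ₛ′ split join split-join join-split

blockPerm : ∀ {N} → Permutation′ ⌈ N /2⌉ → Permutation′ ⌊ N /2⌋ → Permutation′ N
blockPerm σ τ = ↔-trans blocks (↔-trans (σ ⊎-↔ τ) (↔-sym blocks))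

ParityPreserving : ∀ {N} → Permutation′ N → Set
ParityPreserving π = ∀ i → toℕ (π ⟨$⟩ʳ i) % 2 ≡ toℕ i % 2

join-parity : ∀ {N} (p : Fin ⌈ N /2⌉ ⊎ Fin ⌊ N /2⌋) → toℕ (join p) % 2 ≡ [ (λ _ → 0) , (λ _ → 1) ]′ p
join-parity {suc zero}    (inj₁ zero)    = refl
join-parity {suc (suc N)} (inj₁ zero)    = refl
join-parity {suc (suc N)} (inj₁ (suc m)) = join-parity (inj₁ m)
join-parity {suc (suc N)} (inj₂ zero)    = refl
join-parity {suc (suc N)} (inj₂ (suc m)) = join-parity (inj₂ m)

blockPerm-parity : ∀ {N} (σ : Permutation′ ⌈ N /2⌉) (τ : Permutation′ ⌊ N /2⌋) → ParityPreserving (blockPerm {N} σ τ)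
blockPerm-parity σ τ j = begin
  toℕ (join (Sum.map (σ ⟨$⟩ʳ_) (τ ⟨$⟩ʳ_) (split j))) % 2   ≡⟨ join-parity (Sum.map _ _ (split j)) ⟩
  [ (λ _ → 0) , (λ _ → 1) ]′ (Sum.map _ _ (split j))      ≡⟨ [,]-map (split j) ⟩
  [ (λ _ → 0) , (λ _ → 1) ]′ (split j)                     ≡⟨ join-parity (split j) ⟨
  toℕ (join (split j)) % 2                                 ≡⟨ cong (λ i → toℕ i % 2) (join-split j) ⟩
  toℕ j % 2                                                ∎
  where open ≡-Reasoning

interleave : ∀ {N} → (Fin ⌈ N /2⌉ → Bool) → (Fin ⌊ N /2⌋ → Bool) → Fin N → Bool
interleave E O = [ E , O ]′ ∘ split

interleave-≈ₚ : ∀ {N} {E E′ : Fin ⌈ N /2⌉ → Bool} {O O′ : Fin ⌊ N /2⌋ → Bool} →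
  E ≈ₚ E′ → O ≈ₚ O′ → interleave E O ≈ₚ interleave E′ O′
interleave-≈ₚ {E = E} {E′} {O} {O′} (σ , Eσ≗E′) (τ , Oτ≗O′) = blockPerm σ τ , λ j → begin
  [ E , O ]′ (split (join (Sum.map (σ ⟨$⟩ʳ_) (τ ⟨$⟩ʳ_) (split j)))) ≡⟨ cong [ E , O ]′ (split-join _) ⟩
  [ E , O ]′ (Sum.map (σ ⟨$⟩ʳ_) (τ ⟨$⟩ʳ_) (split j))                ≡⟨ [,]-map (split j) ⟩
  [ E ∘ (σ ⟨$⟩ʳ_) , O ∘ (τ ⟨$⟩ʳ_) ]′ (split j)                      ≡⟨ [,]-cong Eσ≗E′ Oτ≗O′ (split j) ⟩
  interleave E′ O′ j                                                ∎
  where open ≡-Reasoning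

interleave-column : ∀ {k N} (P : Tuple k → Set) (E : Fin k → Fin ⌈ N /2⌉ → Bool) (O : Fin k → Fin ⌊ N /2⌋ → Bool) →
  (∀ m → P (λ i → E i m)) → (∀ m → P (λ i → O i m)) → ∀ j → P (λ i → interleave (E i) (O i) j)
interleave-column P E O E-columns O-columns j with split j
... | inj₁ m = E-columns m
... | inj₂ m = O-columns m

NAE-nonconstant : ∀ {k} {v : Tuple k} → NAE k v → ∀ c → ¬ (∀ i → v i ≡ c)
NAE-nonconstant (not-all-false , _) false = not-all-false
NAE-nonconstant (_ , not-all-true)  true  = not-all-true

module _ {k} {R : Rel k} (R-resp : ∀ {u v : Tuple k} → (∀ i → u i ≡ v i) → R u → R v)
         {f : (Fin (suc (k + k)) → Bool) → Bool}
         (f-pol : IsPolymorphism (suc (k + k)) R (NAE k) f) (f-sym : TwoBlockSymmetric k f) where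

  blockValue : ℕ → ℕ → Bool
  blockValue a b = f (interleave (first a) (first b))

  blockValues-nonconstant : (E : Fin k → Fin ⌈ suc (k + k) /2⌉ → Bool) (O : Fin k → Fin ⌊ suc (k + k) /2⌋ → Bool) →
    (∀ m → R (λ i → E i m)) → (∀ m → R (λ i → O i m)) →
    ∀ c → ¬ (∀ i → blockValue (weight (E i)) (weight (O i)) ≡ c)
  blockValues-nonconstant E O E-columns O-columns c constant =
    NAE-nonconstant (f-pol M M-columns) c λ i →
      trans (f-sym (perm (sorted i)) (sorted-parity i) (canonical i)) (constant i)
    where
    open _≈ₚ_
    canonical : Fin k → Fin (suc (k + k)) → Bool
    canonical i = interleave (first (weight (E i))) (first (weight (O i)))
    sorted : ∀ i → canonical i ≈ₚ interleave (E i) (O i)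
    sorted i = interleave-≈ₚ (first-weight≈ₚ (E i)) (first-weight≈ₚ (O i))
    sorted-parity : ∀ i → ParityPreserving (perm (sorted i))
    sorted-parity i = blockPerm-parity (perm (first-weight≈ₚ (E i))) (perm (first-weight≈ₚ (O i)))
    -- Pointwise M is the interleaved matrix, so its columns lie in R, while each row is literally
    -- a parity-preserving rearrangement of a canonical tuple, to which f-sym applies.
    M : Fin k → Fin (suc (k + k)) → Bool
    M i j = canonical i (perm (sorted i) ⟨$⟩ʳ j)
    M-columns : ∀ j → R (λ i → M i j)
    M-columns j = R-resp (λ i → sym (permute (sorted i) j)) (interleave-column R E O E-columns O-columns j)

-- a on the rows of x, b on the rows of z outside x, c on the rest (rows of x outside z do not occur)
profile : ℕ → ℕ → ℕ → Bool → Bool → ℕ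
profile a b c true  _     = a
profile a b c false true  = b
profile a b c false false = c

profile-≤ : ∀ {a b c N} → a ≤ N → b ≤ N → c ≤ N → ∀ u v → profile a b c u v ≤ N
profile-≤ a≤N _   _   true  _     = a≤N
profile-≤ _   b≤N _   false true  = b≤N
profile-≤ _   _   c≤N false false = c≤N

profile-identity : ∀ a b c {u v} → u Bool.≤ v →
  profile a b c u v + (bit u * b + bit v * c) ≡ bit u * a + bit v * b + c
profile-identity a b c {true}  b≤b = identity a b c
  where identity : ∀ a b c → a + (1 * b + 1 * c) ≡ 1 * a + 1 * b + c
        identity = solve-∀
profile-identity a b c {false} f≤t = identity b c
  where identity : ∀ b c → b + (0 + 1 * c) ≡ 0 + 1 * b + c
        identity = solve-∀
profile-identity a b c {false} b≤b = +-identityʳ c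

sum-profile : ∀ {k} a b c {x z : Tuple k} → x ⊆ z →
  sum (λ i → profile a b c (x i) (z i)) + (weight x * b + weight z * c) ≡ weight x * a + weight z * b + k * c
sum-profile {k} a b c {x} {z} x⊆z = begin
  sum P + (weight x * b + weight z * c)           ≡⟨ cong₂ (λ u v → sum P + (u + v)) (weight*≡sum x b) (weight*≡sum z c) ⟩
  sum P + (sum (x ⊛ b) + sum (z ⊛ c)) ≡⟨ cong (sum P +_) (∑-distrib-+ (x ⊛ b) (z ⊛ c)) ⟨
  sum P + sum (λ i → bit (x i) * b + bit (z i) * c) ≡⟨ ∑-distrib-+ P (λ i → bit (x i) * b + bit (z i) * c) ⟨
  sum (λ i → P i + (bit (x i) * b + bit (z i) * c)) ≡⟨ sum-cong-≗ (λ i → profile-identity a b c (x⊆z i)) ⟩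
  sum (λ i → bit (x i) * a + bit (z i) * b + c)   ≡⟨ ∑-distrib-+ (λ i → bit (x i) * a + bit (z i) * b) (λ (_ : Fin k) → c) ⟩
  sum (λ i → bit (x i) * a + bit (z i) * b) + sum {k} (λ _ → c)
                                                  ≡⟨ cong₂ _+_ (∑-distrib-+ (x ⊛ a) (z ⊛ b)) (sum-const k c) ⟩
  sum (x ⊛ a) + sum (z ⊛ b) + k * c   ≡⟨ cong₂ (λ u v → u + v + k * c) (weight*≡sum x a) (weight*≡sum z b) ⟨
  weight x * a + weight z * b + k * c             ∎
  where
  open ≡-Reasoning
  P : Fin k → ℕ
  P i = profile a b c (x i) (z i)
  _⊛_ : Tuple k → ℕ → Fin k → ℕ
  (A ⊛ m) i = bit (A i) * m

sum-profile-≡ : ∀ {k d B C a b c m} {x z : Tuple k} → x ⊆ z → weight x ≡ d → weight z ≡ d + B → d + B + C ≡ k →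
  d * a + B * b + C * c ≡ m → sum (λ i → profile a b c (x i) (z i)) ≡ m
sum-profile-≡ {k} {d} {B} {C} {a} {b} {c} {m} {x} {z} x⊆z wx≡d wz≡d+B d+B+C≡k balanced =
  +-cancelʳ-≡ (d * b + (d + B) * c) _ _ (begin
    sum P + (d * b + (d + B) * c)             ≡⟨ cong₂ (λ u v → sum P + (u * b + v * c)) wx≡d wz≡d+B ⟨
    sum P + (weight x * b + weight z * c)     ≡⟨ sum-profile a b c x⊆z ⟩
    weight x * a + weight z * b + k * c       ≡⟨ cong₂ (λ u v → u * a + v * b + k * c) wx≡d wz≡d+B ⟩
    d * a + (d + B) * b + k * c               ≡⟨ cong (λ n → d * a + (d + B) * b + n * c) d+B+C≡k ⟨
    d * a + (d + B) * b + (d + B + C) * c     ≡⟨ regroup d B C a b c ⟩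
    d * a + B * b + C * c + (d * b + (d + B) * c) ≡⟨ cong (_+ (d * b + (d + B) * c)) balanced ⟩
    m + (d * b + (d + B) * c)                 ∎)
  where
  open ≡-Reasoning
  P : Fin k → ℕ
  P i = profile a b c (x i) (z i)
  regroup : ∀ d B C a b c → d * a + (d + B) * b + (d + B + C) * c ≡ d * a + B * b + C * c + (d * b + (d + B) * c)
  regroup = solve-∀

∃-multiple-above : ∀ m D → 0 < D → ∃₂ λ e c → e * D ≡ m + c × c < D
∃-multiple-above zero    D       0<D = 0 , 0 , refl , 0<D
∃-multiple-above (suc m) D       0<D with ∃-multiple-above m D 0<D
... | e , suc c , eD≡m+1+c , 1+c<D = e , c , trans eD≡m+1+c (+-suc m c) , <-trans (n<1+n c) 1+c<D
∃-multiple-above (suc m) (suc D) _ | e , zero , eD≡m+0 , _ =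
  suc e , D , trans (cong (suc D +_) (trans eD≡m+0 (+-identityʳ m))) (cong suc (+-comm D m)) , n<1+n D

multiple-above-bound : ∀ {e c d D} → e * D ≡ d + D + c → c < D → e ≤ suc d
multiple-above-bound {e} {c} {d} {D@(suc _)} eD≡d+D+c c<D = s≤s⁻¹ (*-cancelʳ-< D e (2 + d) (begin-strict
  e * D         ≡⟨ eD≡d+D+c ⟩
  d + D + c     <⟨ +-monoʳ-< (d + D) c<D ⟩
  d + D + D     ≤⟨ +-monoˡ-≤ D (+-monoˡ-≤ D (m≤m*n d D)) ⟩
  d * D + D + D ≡⟨ identity d D ⟩
  (2 + d) * D   ∎))
  where
  open ≤-Reasoning
  identity : ∀ d D → d * D + D + D ≡ (2 + d) * D
  identity = solve-∀

between-half : ∀ {h lo hi} → h + h ≡ lo + hi → lo ≤ hi → lo ≤ h × h ≤ hi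
between-half {h} {lo} {hi} h+h≡lo+hi lo≤hi = lo≤h , h≤hi
  where
  open ≤-Reasoning
  lo≤h : lo ≤ h
  lo≤h = begin
    lo             ≡⟨ n≡⌊n+n/2⌋ lo ⟩
    ⌊ lo + lo /2⌋  ≤⟨ ⌊n/2⌋-mono (+-monoʳ-≤ lo lo≤hi) ⟩
    ⌊ lo + hi /2⌋  ≡⟨ cong ⌊_/2⌋ h+h≡lo+hi ⟨
    ⌊ h + h /2⌋    ≡⟨ n≡⌊n+n/2⌋ h ⟨
    h              ∎
  h≤hi : h ≤ hi
  h≤hi = begin
    h              ≡⟨ n≡⌊n+n/2⌋ h ⟩
    ⌊ h + h /2⌋    ≡⟨ cong ⌊_/2⌋ h+h≡lo+hi ⟩
    ⌊ lo + hi /2⌋  ≤⟨ ⌊n/2⌋-mono (+-monoˡ-≤ hi lo≤hi) ⟩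
    ⌊ hi + hi /2⌋  ≡⟨ n≡⌊n+n/2⌋ hi ⟨
    hi             ∎

even-sum : ∀ m n → m % 2 ≡ n % 2 → ∃ λ h → h + h ≡ m + n
even-sum zero          zero          _  = 0 , refl
even-sum (suc zero)    (suc zero)    _  = 1 , refl
even-sum (suc (suc m)) n             eq with h , h+h≡m+n ← even-sum m n eq
  = suc h , trans (cong suc (+-suc h h)) (cong (2 +_) h+h≡m+n)
even-sum m             (suc (suc n)) eq with h , h+h≡m+n ← even-sum m n eq
  = suc h , trans (cong suc (+-suc h h))
              (trans (cong (2 +_) h+h≡m+n) (sym (trans (+-suc m (suc n)) (cong suc (+-suc m n)))))

%2-pigeonhole : ∀ a b c → a % 2 ≡ b % 2 ⊎ b % 2 ≡ c % 2 ⊎ a % 2 ≡ c % 2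
%2-pigeonhole (suc (suc a)) b             c             = %2-pigeonhole a b c
%2-pigeonhole a             (suc (suc b)) c             = %2-pigeonhole a b c
%2-pigeonhole a             b             (suc (suc c)) = %2-pigeonhole a b c
%2-pigeonhole zero          zero          _             = inj₁ refl
%2-pigeonhole (suc zero)    (suc zero)    _             = inj₁ refl
%2-pigeonhole zero          (suc zero)    zero          = inj₂ (inj₂ refl)
%2-pigeonhole zero          (suc zero)    (suc zero)    = inj₂ (inj₁ refl)
%2-pigeonhole (suc zero)    zero          zero          = inj₂ (inj₁ refl)
%2-pigeonhole (suc zero)    zero          (suc zero)    = inj₂ (inj₂ refl)

k+t-or-k+d-even : ∀ k t d → (t % 2 ≡ k % 2) ⊎ ¬ (d % 2 ≡ t % 2) →
  (∃ λ h → h + h ≡ k + t) ⊎ (∃ λ h → h + h ≡ k + d)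
k+t-or-k+d-even k t d (inj₁ t≡k) = inj₁ (even-sum k t (sym t≡k))
k+t-or-k+d-even k t d (inj₂ d≢t) with %2-pigeonhole k t d
... | inj₁ k≡t        = inj₁ (even-sum k t k≡t)
... | inj₂ (inj₁ t≡d) = ⊥-elim (d≢t (sym t≡d))
... | inj₂ (inj₂ k≡d) = inj₂ (even-sum k d k≡d)

balance-with-copies : ∀ {d D e c u G t₁ k N} → d + D ≡ suc t₁ → u + e ≡ suc t₁ → e * D ≡ suc t₁ + c →
  d + G + c ≡ k → e + N ≡ suc k → d * u + G * suc t₁ + c * t₁ ≡ suc t₁ * N
balance-with-copies {d} {D} {e} {c} {u} {G} {t₁} {k} {N} d+D≡t u+e≡t eD≡t+c d+G+c≡k e+N≡1+k =
  +-cancelʳ-≡ (t * e) _ _ (begin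
    d * u + G * t + c * t₁ + t * e            ≡⟨ cong (λ n → d * u + G * t + c * t₁ + n * e) d+D≡t ⟨
    d * u + G * t + c * t₁ + (d + D) * e      ≡⟨ regroup₁ d u G t c t₁ D e ⟩
    d * (u + e) + G * t + c * t₁ + e * D      ≡⟨ cong₂ (λ n m → d * n + G * t + c * t₁ + m) u+e≡t eD≡t+c ⟩
    d * t + G * t + c * t₁ + (t + c)          ≡⟨ regroup₂ d G c t₁ ⟩
    t * suc (d + G + c)                       ≡⟨ cong (λ n → t * suc n) d+G+c≡k ⟩
    t * suc k                                 ≡⟨ cong (t *_) e+N≡1+k ⟨
    t * (e + N)                               ≡⟨ trans (*-distribˡ-+ t e N) (+-comm (t * e) (t * N)) ⟩
    t * N + t * e                             ∎)
  where
  open ≡-Reasoning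
  t = suc t₁
  regroup₁ : ∀ d u G t c t₁ D e → d * u + G * t + c * t₁ + (d + D) * e ≡ d * (u + e) + G * t + c * t₁ + e * D
  regroup₁ = solve-∀
  regroup₂ : ∀ d G c t₁ → d * suc t₁ + G * suc t₁ + c * t₁ + (suc t₁ + c) ≡ suc t₁ * suc (d + G + c)
  regroup₂ = solve-∀

no-three-distinct : (a b c : Bool) → a ≢ b → b ≢ c → a ≢ c → ⊥
no-three-distinct true  true  _     a≢b _   _   = a≢b refl
no-three-distinct false false _     a≢b _   _   = a≢b refl
no-three-distinct true  false false _   b≢c _   = b≢c refl
no-three-distinct false true  true  _   b≢c _   = b≢c refl
no-three-distinct true  false true  _   _   a≢c = a≢c refl
no-three-distinct false true  false _   _   a≢c = a≢c refl

module Configurations {k t₁ d : ℕ} (x : Tuple k) (wx≡d : weight x ≡ d) (t≤k : suc t₁ ≤ k)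
  {f : (Fin (suc (k + k)) → Bool) → Bool}
  (f-pol : IsPolymorphism (suc (k + k)) (ItkPlus k (suc t₁) x) (NAE k) f)
  (f-sym : TwoBlockSymmetric k f) where

  t : ℕ
  t = suc t₁

  H : ℕ → Bool
  H a = blockValue ItkPlus-resp f-pol f-sym a t

  t≤⌊1+2k/2⌋ : t ≤ ⌊ suc (k + k) /2⌋
  t≤⌊1+2k/2⌋ = subst (t ≤_) (n≡⌈n+n/2⌉ k) t≤k

  -- The even block: e copies of x and N columns of weight t, giving a further a ones to each of
  -- the d rows of x, b to B further rows and c to the remaining C rows. The odd block: k columns
  -- of weight t, every row carrying t of their ones.
  configuration : ∀ e N B C a b c → e + N ≡ suc k → d + B + C ≡ k → a ≤ N → b ≤ N → c ≤ N →
    d * a + B * b + C * c ≡ t * N → H (e + a) ≡ H c → H b ≡ H c → ⊥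
  configuration e N B C a b c e+N≡1+k d+B+C≡k a≤N b≤N c≤N balanced Ha≡Hc Hb≡Hc
    with z , x⊆z , _ , wz≡d+B ← subset-of-weight (≤-maximum ∘ x) (d + B)
           (≤-trans (≤-reflexive wx≡d) (m≤m+n d B))
           (≤-trans (m≤m+n (d + B) C) (≤-reflexive (trans d+B+C≡k (sym (weight-all-true k)))))
    with E , E-columns , E-rows ← matrix-with-x-columns t x e N (trans e+N≡1+k (cong suc (n≡⌊n+n/2⌋ k)))
           (λ i → profile a b c (x i) (z i)) (λ i → profile-≤ a≤N b≤N c≤N (x i) (z i))
           (sum-profile-≡ x⊆z wx≡d wz≡d+B d+B+C≡k balanced)
    with O , O-columns , O-rows ← matrix-with-margins t ⌊ suc (k + k) /2⌋ (λ _ → t) (λ _ → t≤⌊1+2k/2⌋)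
           (trans (sum-const k t) (trans (*-comm k t) (cong (t *_) (n≡⌈n+n/2⌉ k))))
    = blockValues-nonconstant ItkPlus-resp f-pol f-sym E O E-columns (inj₁ ∘ O-columns) (H c) λ i →
        trans (cong₂ (blockValue ItkPlus-resp f-pol f-sym) (E-rows i) (O-rows i)) (row-value (x i) (z i) (x⊆z i))
    where
    row-value : ∀ u v → u Bool.≤ v → H (e * bit u + profile a b c u v) ≡ H c
    row-value true  _     b≤b = trans (cong (λ n → H (n + a)) (*-identityʳ e)) Ha≡Hc
    row-value false true  f≤t = trans (cong (λ n → H (n + b)) (*-zeroʳ e)) Hb≡Hc
    row-value false false b≤b = cong (λ n → H (n + c)) (*-zeroʳ e)

  H[1+t]≢H[t] : d ≤ t → H (suc t) ≢ H t
  H[1+t]≢H[t] d≤t H[1+t]≡H[t] =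
    configuration 0 (suc k) B C (suc t) (suc t) t refl (trans (cong (_+ C) d+B≡t) t+C≡k)
      (s≤s t≤k) (s≤s t≤k) (m≤n⇒m≤1+n t≤k) balanced H[1+t]≡H[t] H[1+t]≡H[t]
    where
    open ≡-Reasoning
    B = t ∸ d
    C = k ∸ t
    d+B≡t : d + B ≡ t
    d+B≡t = m+[n∸m]≡n d≤t
    t+C≡k : t + C ≡ k
    t+C≡k = m+[n∸m]≡n t≤k
    balanced : d * suc t + B * suc t + C * t ≡ t * suc k
    balanced = begin
      d * suc t + B * suc t + C * t ≡⟨ cong (_+ C * t) (*-distribʳ-+ (suc t) d B) ⟨
      (d + B) * suc t + C * t       ≡⟨ cong (λ n → n * suc t + C * t) d+B≡t ⟩
      t * suc t + C * t             ≡⟨ regroup t C ⟩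
      t * suc (t + C)               ≡⟨ cong (λ n → t * suc n) t+C≡k ⟩
      t * suc k                     ∎
      where regroup : ∀ t C → t * suc t + C * t ≡ t * suc (t + C)
            regroup = solve-∀

  -- With e copies of x the rows of x get t − e further ones; the column sums then force
  -- c = e (t − d) − t rows of weight t − 1, so e is chosen with 0 ≤ c < t − d.
  H[t]≢H[t-1]-with-copies : ∀ e c → e * (t ∸ d) ≡ t + c → c < t ∸ d → d < t → d + t ≤ k → H t ≢ H t₁
  H[t]≢H[t-1]-with-copies e c eD≡t+c c<D d<t d+t≤k H[t]≡H[t-1] =
    configuration e N G c u t t₁ e+N≡1+k d+G+c≡k (≤-trans (m∸n≤m t e) t≤N) t≤N (≤-trans (n≤1+n t₁) t≤N)
      balanced (trans (cong H (trans (+-comm e u) u+e≡t)) H[t]≡H[t-1]) H[t]≡H[t-1]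
    where
    open ≡-Reasoning
    D = t ∸ d
    d+D≡t : d + D ≡ t
    d+D≡t = m+[n∸m]≡n (<⇒≤ d<t)
    s = k ∸ (d + t)
    d+t+s≡k : d + t + s ≡ k
    d+t+s≡k = m+[n∸m]≡n d+t≤k
    e≤1+d : e ≤ suc d
    e≤1+d = multiple-above-bound (trans eD≡t+c (cong (_+ c) (sym d+D≡t))) c<D
    F = suc d ∸ e
    e+F≡1+d : e + F ≡ suc d
    e+F≡1+d = m+[n∸m]≡n e≤1+d
    u = t ∸ e
    u+e≡t : u + e ≡ t
    u+e≡t = m∸n+n≡m (≤-trans e≤1+d d<t)
    G = t + s ∸ c
    c+G≡t+s : c + G ≡ t + s
    c+G≡t+s = m+[n∸m]≡n (≤-trans (<⇒≤ c<D) (≤-trans (m∸n≤m t d) (m≤m+n t s)))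
    N = F + t + s
    t≤N : t ≤ N
    t≤N = ≤-trans (m≤n+m t F) (m≤m+n (F + t) s)
    e+N≡1+k : e + N ≡ suc k
    e+N≡1+k = begin
      e + (F + t + s) ≡⟨ +-assoc e (F + t) s ⟨
      e + (F + t) + s ≡⟨ cong (_+ s) (+-assoc e F t) ⟨
      e + F + t + s   ≡⟨ cong (λ n → n + t + s) e+F≡1+d ⟩
      suc (d + t + s) ≡⟨ cong suc d+t+s≡k ⟩
      suc k           ∎
    d+G+c≡k : d + G + c ≡ k
    d+G+c≡k = begin
      d + G + c   ≡⟨ +-assoc d G c ⟩
      d + (G + c) ≡⟨ cong (d +_) (trans (+-comm G c) c+G≡t+s) ⟩
      d + (t + s) ≡⟨ +-assoc d t s ⟨
      d + t + s   ≡⟨ d+t+s≡k ⟩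
      k           ∎
    balanced : d * u + G * t + c * t₁ ≡ t * N
    balanced = balance-with-copies {d} {D} {e} {c} {u} {G} d+D≡t u+e≡t eD≡t+c d+G+c≡k e+N≡1+k

  H[t]≢H[t-1] : d < t → d + t ≤ k → H t ≢ H t₁
  H[t]≢H[t-1] d<t d+t≤k =
    let e , c , eD≡t+c , c<D = ∃-multiple-above t (t ∸ d) (m<n⇒0<n∸m d<t)
    in H[t]≢H[t-1]-with-copies e c eD≡t+c c<D d<t d+t≤k

  H[1+t]≢H[t-1]-k+t-even : ∀ h → h + h ≡ k + t → d < t → H (suc t) ≢ H t₁
  H[1+t]≢H[t-1]-k+t-even h h+h≡k+t d<t H[1+t]≡H[t-1] =
    configuration 0 (suc k) B C (suc t) (suc t) t₁ refl (trans (cong (_+ C) d+B≡h) h+C≡k)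
      (s≤s t≤k) (s≤s t≤k) (≤-trans (n≤1+n t₁) (m≤n⇒m≤1+n t≤k)) balanced H[1+t]≡H[t-1] H[1+t]≡H[t-1]
    where
    open ≡-Reasoning
    t≤h×h≤k = between-half (trans h+h≡k+t (+-comm k t)) t≤k
    B = h ∸ d
    C = k ∸ h
    d+B≡h : d + B ≡ h
    d+B≡h = m+[n∸m]≡n (≤-trans (<⇒≤ d<t) (proj₁ t≤h×h≤k))
    h+C≡k : h + C ≡ k
    h+C≡k = m+[n∸m]≡n (proj₂ t≤h×h≤k)
    h≡C+t : h ≡ C + t
    h≡C+t = +-cancelˡ-≡ h _ _ (trans h+h≡k+t (trans (cong (_+ t) (sym h+C≡k)) (+-assoc h C t)))
    balanced : d * suc t + B * suc t + C * t₁ ≡ t * suc k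
    balanced = begin
      d * suc t + B * suc t + C * t₁ ≡⟨ cong (_+ C * t₁) (*-distribʳ-+ (suc t) d B) ⟨
      (d + B) * suc t + C * t₁       ≡⟨ cong (λ n → n * suc t + C * t₁) (trans d+B≡h h≡C+t) ⟩
      (C + t) * suc t + C * t₁       ≡⟨ regroup C t₁ ⟩
      t * suc (C + t + C)            ≡⟨ cong (λ n → t * suc (n + C)) h≡C+t ⟨
      t * suc (h + C)                ≡⟨ cong (λ n → t * suc n) h+C≡k ⟩
      t * suc k                      ∎
      where regroup : ∀ C t₁ → (C + suc t₁) * suc (suc t₁) + C * t₁ ≡ suc t₁ * suc (C + suc t₁ + C)
            regroup = solve-∀

  H[1+t]≢H[t-1]-k+d-even : ∀ h → h + h ≡ k + d → d < t → t < k → H (suc t) ≢ H t₁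
  H[1+t]≢H[t-1]-k+d-even h h+h≡k+d d<t t<k H[1+t]≡H[t-1] =
    configuration 1 k B C t (suc t) t₁ refl (trans (cong (_+ C) d+B≡h) h+C≡k)
      t≤k t<k (≤-trans (n≤1+n t₁) t≤k) balanced H[1+t]≡H[t-1] H[1+t]≡H[t-1]
    where
    open ≡-Reasoning
    d≤h×h≤k = between-half (trans h+h≡k+d (+-comm k d)) (≤-trans (<⇒≤ d<t) t≤k)
    B = h ∸ d
    C = k ∸ h
    d+B≡h : d + B ≡ h
    d+B≡h = m+[n∸m]≡n (proj₁ d≤h×h≤k)
    h+C≡k : h + C ≡ k
    h+C≡k = m+[n∸m]≡n (proj₂ d≤h×h≤k)
    B≡C : B ≡ C
    B≡C = +-cancelˡ-≡ d _ _ (+-cancelˡ-≡ h _ _ (begin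
      h + (d + B) ≡⟨ cong (h +_) d+B≡h ⟩
      h + h       ≡⟨ h+h≡k+d ⟩
      k + d       ≡⟨ cong (_+ d) h+C≡k ⟨
      h + C + d   ≡⟨ regroup h C d ⟩
      h + (d + C) ∎))
      where regroup : ∀ h C d → h + C + d ≡ h + (d + C)
            regroup = solve-∀
    balanced : d * t + B * suc t + C * t₁ ≡ t * k
    balanced = begin
      d * t + B * suc t + C * t₁ ≡⟨ cong (λ n → d * t + n * suc t + C * t₁) B≡C ⟩
      d * t + C * suc t + C * t₁ ≡⟨ regroup d C t₁ ⟩
      t * (d + C + C)            ≡⟨ cong (λ n → t * (n + C)) (trans (cong (d +_) (sym B≡C)) d+B≡h) ⟩
      t * (h + C)                ≡⟨ cong (t *_) h+C≡k ⟩
      t * k                      ∎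
      where regroup : ∀ d C t₁ → d * suc t₁ + C * suc (suc t₁) + C * t₁ ≡ suc t₁ * (d + C + C)
            regroup = solve-∀

  H[1+t]≢H[t-1] : d < t → t < k → (∃ λ h → h + h ≡ k + t) ⊎ (∃ λ h → h + h ≡ k + d) → H (suc t) ≢ H t₁
  H[1+t]≢H[t-1] d<t _   (inj₁ (h , h+h≡k+t)) = H[1+t]≢H[t-1]-k+t-even h h+h≡k+t d<t
  H[1+t]≢H[t-1] d<t t<k (inj₂ (h , h+h≡k+d)) = H[1+t]≢H[t-1]-k+d-even h h+h≡k+d d<t t<k

proposition4p5 : (k t d : ℕ) → 3 ≤ k → 1 < t → t < k → 1 ≤ d → d < t → d + t ≤ k →
    (t % 2 ≡ k % 2) ⊎ ¬ (d % 2 ≡ t % 2) →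
    (x : Fin k → Bool) → weight x ≡ d →
    ¬ (Σ ((Fin (suc (k + k)) → Bool) → Bool) λ f →
         IsPolymorphism (suc (k + k)) (ItkPlus k t x) (NAE k) f × TwoBlockSymmetric k f)
proposition4p5 k (suc t₁) d _ _ t<k _ d<t d+t≤k parity x wx≡d (f , f-pol , f-sym) =
  no-three-distinct (H (suc t)) (H t) (H t₁)
    (H[1+t]≢H[t] (<⇒≤ d<t))
    (H[t]≢H[t-1] d<t d+t≤k)
    (H[1+t]≢H[t-1] d<t t<k (k+t-or-k+d-even k t d parity))
  where open Configurations x wx≡d (<⇒≤ t<k) f-pol f-sym
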